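{- Let $(a,b,c)$ be a primitive Pythagorean triple and let $E$ be the elliptic curve over $\mathbb{Q}$ given by $y^2=x(x-a^2)(x-b^2)$. Then $E(\mathbb{Q})$ has no point of order $4$.
   Context: A primitive Pythagorean triple is a triple $(a,b,c)$ of positive integers with no common divisor satisfying $a^2+b^2=c^2$. $E(\mathbb{Q})$ denotes the group of rational points of $E$ together with the point at infinity $O$. -}

module Defs where

open import Data.Nat as ℕ using (ℕ)
open import Data.Nat.GCD using (gcd)
open import Data.Integer as ℤ using (+_)
open import Data.Rational using (ℚ; 0ℚ; _+_; _*_; _-_; -_; _÷_; _/_; ≢-nonZero)
open import Data.Rational.Properties using (_≟_)
open import Data.Product using (_×_; Σ)
open import Data.Unit using (⊤)
open import Relation.Nullary using (yes; no; ¬_)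
open import Relation.Binary.PropositionalEquality using (_≡_)

PrimitivePythagoreanTriple : ℕ → ℕ → ℕ → Set
PrimitivePythagoreanTriple a b c =
  (0 ℕ.< a) × (0 ℕ.< b) × (0 ℕ.< c) ×
  (gcd (gcd a b) c ≡ 1) ×
  (a ℕ.* a ℕ.+ b ℕ.* b ≡ c ℕ.* c)

ι : ℕ → ℚ
ι n = (+ n) / 1

data Point : Set where
  O  : Point
  pt : ℚ → ℚ → Point

record Curve : Set where
  constructor curve
  field
    a₂ a₄ a₆ : ℚ

open Curve

OnCurve : Curve → Point → Set
OnCurve E O = ⊤
OnCurve E (pt x y) = y * y ≡ x * x * x + a₂ E * x * x + a₄ E * x + a₆ E

-- total division (the zero-denominator branch is never used on curve points)
_⊘_ : ℚ → ℚ → ℚ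
p ⊘ q with q ≟ 0ℚ
... | yes _  = 0ℚ
... | no q≢0 = _÷_ p q {{≢-nonZero q≢0}}

add : Curve → Point → Point → Point
add E O Q = Q
add E P O = P
add E (pt x₁ y₁) (pt x₂ y₂) with x₁ ≟ x₂
... | no _ = third ((y₂ - y₁) ⊘ (x₂ - x₁))
  where
  third : ℚ → Point
  third λ' = let x₃ = λ' * λ' - a₂ E - x₁ - x₂ in pt x₃ (- (λ' * (x₃ - x₁) + y₁))
... | yes _ with y₁ + y₂ ≟ 0ℚ
...   | yes _ = O
...   | no _  = third ((ι 3 * x₁ * x₁ + ι 2 * a₂ E * x₁ + a₄ E) ⊘ (ι 2 * y₁))
  where
  third : ℚ → Point
  third λ' = let x₃ = λ' * λ' - a₂ E - x₁ - x₂ in pt x₃ (- (λ' * (x₃ - x₁) + y₁))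

HasOrder4 : Curve → Point → Set
HasOrder4 E P = let P2 = add E P P in ¬ (P2 ≡ O) × (add E P2 P2 ≡ O)

-- E_{a,b} : y² = x(x - a²)(x - b²) = x³ - (a²+b²) x² + a²b² x
E-ab : ℕ → ℕ → Curve
E-ab a b = curve (- (ι (a ℕ.* a) + ι (b ℕ.* b))) (ι (a ℕ.* a) * ι (b ℕ.* b)) 0ℚ

{-# OPTIONS --safe #-}
module Submission where

-- If P has order 4 then 2P = (s , 0) has order 2, so s is a root 0, a² or b² of
-- x (x − a²) (x − b²); and since 2P is a double, the tangent formulas make s − a² and
-- s − b² rational squares. So one of a² − b², b² − a², −b² is a rational square, hence
-- (clearing denominators) a natural square. The last is impossible; a² = b² + d² with
-- a² + b² = c² gives a⁴ − b⁴ = (cd)², which Fermat's descent through the parametrisation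
-- of primitive Pythagorean triples excludes (and d = 0 would force a = b = 1, c² = 2).

open import Defs
open import Data.Nat using (ℕ)
open import Data.Product using (_×_)
open import Relation.Nullary using (¬_)

module NatSquares where

  open import Data.Nat
  open import Data.Nat.Properties
  open import Data.Nat.Divisibility
  open import Data.Nat.DivMod using (m/n*n≡m)
  open import Data.Nat.GCD
  open import Data.Nat.Coprimality as Coprime using (Coprime; coprime-divisor; coprime-/gcd)
  open import Data.Nat.Tactic.RingSolver using (solve-∀; solve)
  open import Data.List.Base using (_∷_; [])
  open import Data.Product
  open import Data.Sum
  open import Function using (_∘_)
  open import Relation.Nullary using (yes; no)
  open import Relation.Binary.PropositionalEquality

  IsSquare : ℕ → Set
  IsSquare n = ∃[ r ] n ≡ r * r

  *-≢0 : ∀ {m n} → m ≢ 0 → n ≢ 0 → m * n ≢ 0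
  *-≢0 {m} m≢0 n≢0 = [ m≢0 , n≢0 ]′ ∘ m*n≡0⇒m≡0∨n≡0 m

  *-≢0ˡ : ∀ {m n} → m * n ≢ 0 → m ≢ 0
  *-≢0ˡ mn≢0 refl = mn≢0 refl

  *-≢0ʳ : ∀ {m n} → m * n ≢ 0 → n ≢ 0
  *-≢0ʳ {m} mn≢0 refl = mn≢0 (*-zeroʳ m)

  square≢0 : ∀ {n} → n ≢ 0 → n * n ≢ 0
  square≢0 n≢0 = *-≢0 n≢0 n≢0

  n≤n*n : ∀ n → n ≤ n * n
  n≤n*n zero    = z≤n
  n≤n*n (suc n) = m≤m*n (suc n) (suc n)

  square-cancel-≤ : ∀ {m n} → m * m ≤ n * n → m ≤ n
  square-cancel-≤ m²≤n² = ≮⇒≥ λ n<m → <⇒≱ (*-mono-< n<m n<m) m²≤n²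

  square-cancel-< : ∀ {m n} → m * m < n * n → m < n
  square-cancel-< m²<n² = ≰⇒> λ n≤m → <⇒≱ m²<n² (*-mono-≤ n≤m n≤m)

  square-injective : ∀ {m n} → m * m ≡ n * n → m ≡ n
  square-injective e = ≤-antisym (square-cancel-≤ (≤-reflexive e)) (square-cancel-≤ (≤-reflexive (sym e)))

  coprime-∣ˡ : ∀ {a b d} → d ∣ a → Coprime a b → Coprime d b
  coprime-∣ˡ d∣a coprime (e∣d , e∣b) = coprime (∣-trans e∣d d∣a , e∣b)

  coprime-*ʳ : ∀ {a b c} → Coprime a b → Coprime a c → Coprime a (b * c)
  coprime-*ʳ a⊥b a⊥c (d∣a , d∣bc) = a⊥c (d∣a , coprime-divisor (coprime-∣ˡ d∣a a⊥b) d∣bc)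

  coprime-*ˡ : ∀ {a b c} → Coprime a c → Coprime b c → Coprime (a * b) c
  coprime-*ˡ a⊥c b⊥c = Coprime.sym (coprime-*ʳ (Coprime.sym a⊥c) (Coprime.sym b⊥c))

  coprime-square : ∀ {a b} → Coprime a b → Coprime (a * a) (b * b)
  coprime-square a⊥b = coprime-*ʳ a²⊥b a²⊥b
    where a²⊥b = coprime-*ˡ a⊥b a⊥b

  coprime-square⁻ : ∀ {a b} → Coprime (a * a) (b * b) → Coprime a b
  coprime-square⁻ {a} {b} a²⊥b² (d∣a , d∣b) = a²⊥b² (∣m⇒∣m*n a d∣a , ∣m⇒∣m*n b d∣b)

  gcd-factorisation : ∀ m n → gcd m n ≢ 0 →
    ∃₂ λ m′ n′ → Coprime m′ n′ × m ≡ m′ * gcd m n × n ≡ n′ * gcd m n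
  gcd-factorisation m n g≢0 =
    m / gcd m n , n / gcd m n , coprime-/gcd m n ,
    sym (m/n*n≡m (gcd[m,n]∣m m n)) , sym (m/n*n≡m (gcd[m,n]∣n m n))
    where instance _ = ≢-nonZero g≢0

  square-* : ∀ a b → (a * b) * (a * b) ≡ (a * a) * (b * b)
  square-* = solve-∀

  m*m∣n*n⇒m∣n : ∀ {m n} → m * m ∣ n * n → m ∣ n
  m*m∣n*n⇒m∣n {m} {n} m²∣n² with gcd m n ≟ 0
  ... | yes g≡0 = subst₂ _∣_ (sym (gcd[m,n]≡0⇒m≡0 g≡0)) (sym (gcd[m,n]≡0⇒n≡0 m g≡0)) ∣-refl
  ... | no g≢0 with gcd-factorisation m n g≢0
  ... | m′ , n′ , m′⊥n′ , m≡m′g , n≡n′g = subst₂ _∣_ g≡m (sym n≡n′g) (n∣m*n n′)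
    where
    g = gcd m n
    instance _ = ≢-nonZero (*-≢0 g≢0 g≢0)
    m′²g²∣n′²g² : m′ * m′ * (g * g) ∣ n′ * n′ * (g * g)
    m′²g²∣n′²g² = subst₂ _∣_ (trans (cong (λ k → k * k) m≡m′g) (square-* m′ g))
                              (trans (cong (λ k → k * k) n≡n′g) (square-* n′ g)) m²∣n²
    m′≡1 : m′ ≡ 1
    m′≡1 = coprime-*ʳ m′⊥n′ m′⊥n′ (∣-refl , ∣-trans (m∣m*n m′) (*-cancelʳ-∣ (g * g) m′²g²∣n′²g²))
    g≡m : g ≡ m
    g≡m = sym (trans m≡m′g (trans (cong (_* g) m′≡1) (*-identityˡ g)))

  -- With g = gcd m k, m = m′g and k = k′g one gets m′n = gk′², so m′ ∣ g; the cofactor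
  -- g / m′ divides both m and n, hence is 1, and m = m′².
  coprime-factor-of-square : ∀ {m n k} → Coprime m n → m * n ≡ k * k → IsSquare m
  coprime-factor-of-square {m} {n} {k} m⊥n mn≡k² with m ≟ 0
  ... | yes m≡0 = 0 , m≡0
  ... | no m≢0 with gcd m k | gcd[m,n]≢0 m k (inj₁ m≢0) | gcd-factorisation m k (gcd[m,n]≢0 m k (inj₁ m≢0))
  ... | g | g≢0 | m′ , k′ , m′⊥k′ , m≡m′g , k≡k′g = m′ , m≡m′m′
    where
    open ≡-Reasoning
    instance
      _ = ≢-nonZero g≢0
      _ = ≢-nonZero {m′} λ { refl → m≢0 m≡m′g }
    m′n≡gk′² : m′ * n ≡ g * (k′ * k′)
    m′n≡gk′² = *-cancelˡ-≡ _ _ g (begin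
      g * (m′ * n)             ≡⟨ solve (g ∷ m′ ∷ n ∷ []) ⟩
      m′ * g * n               ≡⟨ cong (_* n) m≡m′g ⟨
      m * n                    ≡⟨ mn≡k² ⟩
      k * k                    ≡⟨ cong (λ x → x * x) k≡k′g ⟩
      k′ * g * (k′ * g)        ≡⟨ solve (k′ ∷ g ∷ []) ⟩
      g * (g * (k′ * k′))      ∎)
    m′∣g : m′ ∣ g
    m′∣g = coprime-divisor (coprime-*ʳ m′⊥k′ m′⊥k′)
             (subst (m′ ∣_) (trans m′n≡gk′² (*-comm g _)) (m∣m*n n))
    m≡m′m′ : m ≡ m′ * m′
    m≡m′m′ with m′∣g
    ... | divides t g≡tm′ = trans m≡t[m′m′] (trans (cong (_* (m′ * m′)) t≡1) (*-identityˡ _))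
      where
      n≡tk′² : n ≡ t * (k′ * k′)
      n≡tk′² = *-cancelˡ-≡ _ _ m′ (begin
        m′ * n               ≡⟨ m′n≡gk′² ⟩
        g * (k′ * k′)        ≡⟨ cong (_* (k′ * k′)) g≡tm′ ⟩
        t * m′ * (k′ * k′)   ≡⟨ solve (t ∷ m′ ∷ k′ ∷ []) ⟩
        m′ * (t * (k′ * k′)) ∎)
      m≡t[m′m′] : m ≡ t * (m′ * m′)
      m≡t[m′m′] = begin
        m             ≡⟨ m≡m′g ⟩
        m′ * g        ≡⟨ cong (m′ *_) g≡tm′ ⟩
        m′ * (t * m′) ≡⟨ solve (m′ ∷ t ∷ []) ⟩
        t * (m′ * m′) ∎
      t≡1 : t ≡ 1
      t≡1 = m⊥n (subst (t ∣_) (sym m≡t[m′m′]) (m∣m*n _) , subst (t ∣_) (sym n≡tk′²) (m∣m*n _))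

  coprime-factors-of-square : ∀ {m n k} → Coprime m n → m * n ≡ k * k → IsSquare m × IsSquare n
  coprime-factors-of-square {m} {n} {k} m⊥n mn≡k² =
    coprime-factor-of-square {k = k} m⊥n mn≡k² ,
    coprime-factor-of-square {k = k} (Coprime.sym m⊥n) (trans (*-comm n m) mn≡k²)

  even-or-odd : ∀ n → (∃[ k ] n ≡ 2 * k) ⊎ (∃[ k ] n ≡ suc (2 * k))
  even-or-odd zero = inj₁ (0 , refl)
  even-or-odd (suc n) with even-or-odd n
  ... | inj₁ (k , refl) = inj₂ (k , refl)
  ... | inj₂ (k , refl) = inj₁ (suc k , cong suc (sym (+-suc k (k + 0))))

module PythagoreanTriples where

  open import Data.Nat
  open import Data.Nat.Properties
  open import Data.Nat.Divisibility
  open import Data.Nat.Coprimality as Coprime using (Coprime)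
  open import Data.Nat.Primality using (euclidsLemma; prime[2])
  open import Data.Nat.Tactic.RingSolver using (solve)
  open import Data.List.Base using (_∷_; [])
  open import Data.Product
  open import Data.Sum
  open import Data.Empty using (⊥-elim)
  open import Function using (id)
  open import Relation.Binary.PropositionalEquality
  open NatSquares

  record EuclidParametrisation (X Y Z : ℕ) : Set where
    field
      m n        : ℕ
      m⊥n        : Coprime m n
      odd-leg    : X + n * n ≡ m * m   -- X = m² − n², avoiding truncated subtraction
      even-leg   : Y ≡ 2 * (m * n)
      hypotenuse : Z ≡ m * m + n * n

  2∣n*n⇒2∣n : ∀ {n} → 2 ∣ n * n → 2 ∣ n
  2∣n*n⇒2∣n {n} 2∣n² = reduce (euclidsLemma n n prime[2] 2∣n²)

  private
    hypotenuse-excess-even : ∀ {X k t} → X * X + t * 2 * (t * 2) ≡ (X + k) * (X + k) → 2 ∣ k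
    hypotenuse-excess-even {X} {k} {t} e =
      [ id , (λ 2∣2X+k → ∣m+n∣m⇒∣n 2∣2X+k (divides X (*-comm 2 X))) ]′
        (euclidsLemma k (2 * X + k) prime[2] (divides (t * t * 2) k[2X+k]≡4t²))
      where
      k[2X+k]≡4t² : k * (2 * X + k) ≡ t * t * 2 * 2
      k[2X+k]≡4t² = +-cancelˡ-≡ (X * X) _ _ (begin
        X * X + k * (2 * X + k)  ≡⟨ solve (X ∷ k ∷ []) ⟩
        (X + k) * (X + k)        ≡⟨ e ⟨
        X * X + t * 2 * (t * 2)  ≡⟨ solve (X ∷ t ∷ []) ⟩
        X * X + t * t * 2 * 2    ∎)
        where open ≡-Reasoning

    parametrisation-from-excess : ∀ {X t v} → Coprime X (t * 2) →
      X * X + t * 2 * (t * 2) ≡ (X + v * 2) * (X + v * 2) →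
      EuclidParametrisation X (t * 2) (X + v * 2)
    parametrisation-from-excess {X} {t} {v} X⊥Y e = record
      { m = m ; n = n ; m⊥n = m⊥n
      ; odd-leg = trans (cong (X +_) (sym v≡n²)) X+v≡m²
      ; even-leg = trans (*-comm t 2) (cong (2 *_) t≡mn)
      ; hypotenuse = begin
          X + v * 2    ≡⟨ solve (X ∷ v ∷ []) ⟩
          X + v + v    ≡⟨ cong₂ _+_ X+v≡m² v≡n² ⟩
          m * m + n * n ∎
      }
      where
      open ≡-Reasoning
      4v[X+v]≡Y² : 4 * (v * (X + v)) ≡ t * 2 * (t * 2)
      4v[X+v]≡Y² = +-cancelˡ-≡ (X * X) _ _ (begin
        X * X + 4 * (v * (X + v))      ≡⟨ solve (X ∷ v ∷ []) ⟩
        (X + v * 2) * (X + v * 2)      ≡⟨ e ⟨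
        X * X + t * 2 * (t * 2)        ∎)
      v[X+v]≡t² : v * (X + v) ≡ t * t
      v[X+v]≡t² = *-cancelˡ-≡ _ _ 4 (begin
        4 * (v * (X + v))  ≡⟨ 4v[X+v]≡Y² ⟩
        t * 2 * (t * 2)    ≡⟨ solve (t ∷ []) ⟩
        4 * (t * t)        ∎)
      v⊥X+v : Coprime v (X + v)
      v⊥X+v {d} (d∣v , d∣X+v) = coprime-*ʳ X⊥Y X⊥Y
        ( ∣m+n∣m⇒∣n (subst (d ∣_) (+-comm X v) d∣X+v) d∣v
        , subst (d ∣_) 4v[X+v]≡Y² (∣n⇒∣m*n 4 (∣m⇒∣m*n (X + v) d∣v)))
      squares = coprime-factors-of-square {k = t} v⊥X+v v[X+v]≡t²
      n = proj₁ (proj₁ squares)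
      m = proj₁ (proj₂ squares)
      v≡n² : v ≡ n * n
      v≡n² = proj₂ (proj₁ squares)
      X+v≡m² : X + v ≡ m * m
      X+v≡m² = proj₂ (proj₂ squares)
      m⊥n : Coprime m n
      m⊥n = coprime-square⁻ (Coprime.sym (subst₂ Coprime v≡n² X+v≡m² v⊥X+v))
      t≡mn : t ≡ m * n
      t≡mn = square-injective (begin
        t * t                ≡⟨ v[X+v]≡t² ⟨
        v * (X + v)          ≡⟨ cong₂ _*_ v≡n² X+v≡m² ⟩
        n * n * (m * m)      ≡⟨ *-comm (n * n) (m * m) ⟩
        m * m * (n * n)      ≡⟨ square-* m n ⟨
        m * n * (m * n)      ∎)

  euclid-parametrisation-of-even-leg : ∀ {X Y Z} → Coprime X Y → 2 ∣ Y →
    X * X + Y * Y ≡ Z * Z → EuclidParametrisation X Y Z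
  euclid-parametrisation-of-even-leg {X} {Y} {Z} X⊥Y (divides t refl) e
    with m≤n⇒∃[o]m+o≡n (square-cancel-≤ {X} {Z} (subst (X * X ≤_) e (m≤m+n (X * X) (Y * Y))))
  ... | k , refl with hypotenuse-excess-even {X} {k} {t} e
  ... | divides v refl = parametrisation-from-excess {X} {t} {v} X⊥Y e

  odd-squares-sum-not-square : ∀ i j Z → suc (2 * i) * suc (2 * i) + suc (2 * j) * suc (2 * j) ≢ Z * Z
  odd-squares-sum-not-square i j Z e with even-or-odd Z
  ... | inj₁ (k , refl) = even≢odd (k * k) (i * i + i + (j * j + j)) (*-cancelˡ-≡ _ _ 2 (begin
    2 * (2 * (k * k))                                          ≡⟨ solve (k ∷ []) ⟩
    2 * k * (2 * k)                                            ≡⟨ e ⟨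
    suc (2 * i) * suc (2 * i) + suc (2 * j) * suc (2 * j)      ≡⟨ solve (i ∷ j ∷ []) ⟩
    2 * suc (2 * (i * i + i + (j * j + j)))                    ∎))
    where open ≡-Reasoning
  ... | inj₂ (k , refl) = even≢odd (suc (2 * (i * i + i + (j * j + j)))) (2 * (k * k + k)) (begin
    2 * suc (2 * (i * i + i + (j * j + j)))                    ≡⟨ solve (i ∷ j ∷ []) ⟩
    suc (2 * i) * suc (2 * i) + suc (2 * j) * suc (2 * j)      ≡⟨ e ⟩
    suc (2 * k) * suc (2 * k)                                  ≡⟨ solve (k ∷ []) ⟩
    suc (2 * (2 * (k * k + k)))                                ∎)
    where open ≡-Reasoning

  euclid-parametrisation : ∀ {X Y Z} → Coprime X Y → X * X + Y * Y ≡ Z * Z →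
    EuclidParametrisation X Y Z ⊎ EuclidParametrisation Y X Z
  euclid-parametrisation {X} {Y} {Z} X⊥Y e with even-or-odd X | even-or-odd Y
  ... | _               | inj₁ (j , refl) =
    inj₁ (euclid-parametrisation-of-even-leg X⊥Y (divides j (*-comm 2 j)) e)
  ... | inj₁ (i , refl) | _               =
    inj₂ (euclid-parametrisation-of-even-leg (Coprime.sym X⊥Y) (divides i (*-comm 2 i)) (trans (+-comm (Y * Y) (X * X)) e))
  ... | inj₂ (i , refl) | inj₂ (j , refl) = ⊥-elim (odd-squares-sum-not-square i j Z e)

module FourthPowers where

  open import Data.Nat
  open import Data.Nat.Properties
  open import Data.Nat.Divisibility
  open import Data.Nat.GCD using (gcd; gcd-comm; gcd-greatest)
  open import Data.Nat.Coprimality as Coprime using (Coprime)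
  open import Data.Nat.Induction using (<-rec)
  open import Data.Nat.Tactic.RingSolver using (solve)
  open import Data.List.Base using (_∷_; [])
  open import Data.Product
  open import Data.Sum
  open import Relation.Nullary using (yes; no)
  open import Relation.Binary.PropositionalEquality
  open NatSquares
  open PythagoreanTriples

  record QuarticSolution (x : ℕ) : Set where
    constructor quartic-solution
    field
      y z : ℕ
      x⊥y : Coprime x y
      y≢0 : y ≢ 0
      z≢0 : z ≢ 0
      x⁴≡y⁴+z² : x * x * (x * x) ≡ y * y * (y * y) + z * z

  SmallerQuarticSolution : ℕ → Set
  SmallerQuarticSolution x = ∃[ x′ ] x′ < x × QuarticSolution x′

  descent-for-odd-y : ∀ {x y z} → y ≢ 0 → z ≢ 0 →
    EuclidParametrisation (y * y) z (x * x) → SmallerQuarticSolution x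
  descent-for-odd-y {x} {y} {z} y≢0 z≢0
    record { m = m ; n = n ; m⊥n = m⊥n ; odd-leg = odd-leg ; even-leg = even-leg ; hypotenuse = hypotenuse } =
    m , m<x , quartic-solution n (x * y) m⊥n n≢0 (*-≢0 x≢0 y≢0) m⁴≡n⁴+[xy]²
    where
    open ≡-Reasoning
    n≢0 : n ≢ 0
    n≢0 refl = z≢0 (trans even-leg (cong (2 *_) (*-zeroʳ m)))
    m<x : m < x
    m<x = square-cancel-< (subst (m * m <_) (sym hypotenuse) (m<m+n (m * m) (n≢0⇒n>0 (square≢0 n≢0))))
    x≢0 : x ≢ 0
    x≢0 refl = <⇒≱ m<x z≤n
    m⁴≡n⁴+[xy]² : m * m * (m * m) ≡ n * n * (n * n) + x * y * (x * y)
    m⁴≡n⁴+[xy]² = begin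
      m * m * (m * m)                              ≡⟨ cong (λ k → k * k) odd-leg ⟨
      (y * y + n * n) * (y * y + n * n)            ≡⟨ solve (y ∷ n ∷ []) ⟩
      n * n * (n * n) + (y * y + n * n + n * n) * (y * y)
        ≡⟨ cong (λ k → n * n * (n * n) + (k + n * n) * (y * y)) odd-leg ⟩
      n * n * (n * n) + (m * m + n * n) * (y * y)  ≡⟨ cong (λ k → n * n * (n * n) + k * (y * y)) hypotenuse ⟨
      n * n * (n * n) + x * x * (y * y)            ≡⟨ cong (n * n * (n * n) +_) (square-* x y) ⟨
      n * n * (n * n) + x * y * (x * y)            ∎

  coprime-to-legs : ∀ {u r s} → Coprime r s → u + s * s ≡ r * r → Coprime u (r * s)
  coprime-to-legs {u} {r} {s} r⊥s u+s²≡r² = coprime-*ʳ u⊥r u⊥s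
    where
    u⊥r : Coprime u r
    u⊥r {d} (d∣u , d∣r) =
      coprime-*ʳ r⊥s r⊥s (d∣r , ∣m+n∣m⇒∣n (subst (d ∣_) (sym u+s²≡r²) (∣m⇒∣m*n r d∣r)) d∣u)
    u⊥s : Coprime u s
    u⊥s {d} (d∣u , d∣s) =
      coprime-*ˡ r⊥s r⊥s (subst (d ∣_) u+s²≡r² (∣m∣n⇒∣m+n d∣u (∣m⇒∣m*n s d∣s)) , d∣s)

  private
    half-square : ∀ {j u w} → j * 2 * (j * 2) ≡ 2 * (u * (2 * w)) → u * w ≡ j * j
    half-square {j} {u} {w} e = *-cancelˡ-≡ _ _ 4 (begin
      4 * (u * w)         ≡⟨ solve (u ∷ w ∷ []) ⟩
      2 * (u * (2 * w))   ≡⟨ e ⟨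
      j * 2 * (j * 2)     ≡⟨ solve (j ∷ []) ⟩
      4 * (j * j)         ∎)
      where open ≡-Reasoning

  -- With v = 2rs, the factors u, r, s of (y/2)² are pairwise coprime, hence squares
  -- u = L², r = p², s = q², and u + s² = r² becomes p⁴ = q⁴ + L² with p ≤ r < x.
  descent-for-even-y : ∀ {x y u v} → y ≢ 0 → EuclidParametrisation u v x →
    y * y ≡ 2 * (u * v) → SmallerQuarticSolution x
  descent-for-even-y {x} {y} {u} y≢0
    record { m = r ; n = s ; m⊥n = r⊥s ; odd-leg = u+s²≡r² ; even-leg = refl ; hypotenuse = x≡r²+s² } y²≡2uv
    with 2∣n*n⇒2∣n {y} (divides (u * (2 * (r * s))) (trans y²≡2uv (*-comm 2 (u * (2 * (r * s))))))
  ... | divides j refl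
    with coprime-factors-of-square {k = j} (coprime-to-legs r⊥s u+s²≡r²) (half-square {j} {u} {r * s} y²≡2uv)
  ... | (L , refl) , (K , rs≡K²) with coprime-factors-of-square {k = K} r⊥s rs≡K²
  ... | (p , refl) , (q , refl) =
    p , p<x , quartic-solution q L (coprime-square⁻ r⊥s) q≢0 L≢0 p⁴≡q⁴+L²
    where
    urs≢0 : L * L * (p * p * (q * q)) ≢ 0
    urs≢0 = subst (_≢ 0) (sym (half-square {j} {L * L} y²≡2uv)) (square≢0 {j} λ { refl → y≢0 refl })
    L≢0 : L ≢ 0
    L≢0 = *-≢0ˡ {L} (*-≢0ˡ {L * L} urs≢0)
    q≢0 : q ≢ 0
    q≢0 = *-≢0ˡ {q} (*-≢0ʳ {p * p} (*-≢0ʳ {L * L} urs≢0))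
    p<x : p < x
    p<x = ≤-<-trans (≤-trans (n≤n*n p) (n≤n*n (p * p)))
            (subst (p * p * (p * p) <_) (sym x≡r²+s²) (m<m+n _ (n≢0⇒n>0 (square≢0 (square≢0 q≢0)))))
    p⁴≡q⁴+L² : p * p * (p * p) ≡ q * q * (q * q) + L * L
    p⁴≡q⁴+L² = trans (sym u+s²≡r²) (+-comm (L * L) _)

  quartic-legs-coprime : ∀ {x y z} → Coprime x y → x * x * (x * x) ≡ y * y * (y * y) + z * z →
    Coprime (y * y) z
  quartic-legs-coprime {x} {y} {z} x⊥y e {d} (d∣y² , d∣z) =
    coprime-*ʳ y²⊥x² y²⊥x²
      (d∣y² , subst (d ∣_) (sym e) (∣m∣n⇒∣m+n (∣m⇒∣m*n (y * y) d∣y²) (∣m⇒∣m*n z d∣z)))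
    where y²⊥x² = coprime-square (Coprime.sym x⊥y)

  quartic-descent : ∀ {x} → QuarticSolution x → SmallerQuarticSolution x
  quartic-descent (quartic-solution y z x⊥y y≢0 z≢0 e)
    with euclid-parametrisation (quartic-legs-coprime x⊥y e) (sym e)
  ... | inj₁ p = descent-for-odd-y y≢0 z≢0 p
  ... | inj₂ record { m = m ; n = n ; m⊥n = m⊥n ; even-leg = y²≡2mn ; hypotenuse = x²≡m²+n² }
    with euclid-parametrisation m⊥n (sym x²≡m²+n²)
  ...   | inj₁ q = descent-for-even-y y≢0 q y²≡2mn
  ...   | inj₂ q = descent-for-even-y y≢0 q (trans y²≡2mn (cong (2 *_) (*-comm m n)))

  no-quartic-solution : ∀ x → ¬ QuarticSolution x
  no-quartic-solution = <-rec _ λ x smaller s →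
    let x′ , x′<x , s′ = quartic-descent s in smaller x′<x s′

  primitive-triple-coprime-legs : ∀ {a b c} → PrimitivePythagoreanTriple a b c → Coprime a b
  primitive-triple-coprime-legs {a} {b} {c} (_ , _ , _ , gcd≡1 , a²+b²≡c²) {d} (d∣a , d∣b) =
    ∣1⇒≡1 (subst (d ∣_) gcd≡1 (gcd-greatest (gcd-greatest d∣a d∣b) d∣c))
    where
    d∣c : d ∣ c
    d∣c = m*m∣n*n⇒m∣n (subst (d * d ∣_) a²+b²≡c² (∣m∣n⇒∣m+n (*-pres-∣ d∣a d∣a) (*-pres-∣ d∣b d∣b)))

  legs-differ-by-non-square : ∀ {a b c} d → PrimitivePythagoreanTriple a b c → a * a ≢ b * b + d * d
  legs-differ-by-non-square {a} {b} {c} d t@(_ , 0<b , 0<c , _ , a²+b²≡c²) a²≡b²+d² with d ≟ 0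
  ... | yes refl with square-injective {a} {b} (trans a²≡b²+d² (+-identityʳ (b * b)))
  ...   | refl with primitive-triple-coprime-legs t (∣-refl , ∣-refl)
  ...     | refl = odd-squares-sum-not-square 0 0 c a²+b²≡c²
  legs-differ-by-non-square {a} {b} {c} d t@(_ , 0<b , 0<c , _ , a²+b²≡c²) a²≡b²+d² | no d≢0 =
    no-quartic-solution a (quartic-solution b (c * d) (primitive-triple-coprime-legs t)
      (n>0⇒n≢0 0<b) (*-≢0 (n>0⇒n≢0 0<c) d≢0) a⁴≡b⁴+[cd]²)
    where
    open ≡-Reasoning
    a⁴≡b⁴+[cd]² : a * a * (a * a) ≡ b * b * (b * b) + c * d * (c * d)
    a⁴≡b⁴+[cd]² = begin
      a * a * (a * a)                                     ≡⟨ cong (λ k → k * k) a²≡b²+d² ⟩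
      (b * b + d * d) * (b * b + d * d)                   ≡⟨ solve (b ∷ d ∷ []) ⟩
      b * b * (b * b) + (b * b + d * d + b * b) * (d * d) ≡⟨ cong (λ k → b * b * (b * b) + (k + b * b) * (d * d)) a²≡b²+d² ⟨
      b * b * (b * b) + (a * a + b * b) * (d * d)         ≡⟨ cong (λ k → b * b * (b * b) + k * (d * d)) a²+b²≡c² ⟩
      b * b * (b * b) + c * c * (d * d)                   ≡⟨ cong (b * b * (b * b) +_) (square-* c d) ⟨
      b * b * (b * b) + c * d * (c * d)                   ∎

  primitive-triple-swap : ∀ {a b c} → PrimitivePythagoreanTriple a b c → PrimitivePythagoreanTriple b a c
  primitive-triple-swap {a} {b} {c} (0<a , 0<b , 0<c , gcd≡1 , a²+b²≡c²) =
    0<b , 0<a , 0<c , trans (cong (λ g → gcd g c) (gcd-comm b a)) gcd≡1 , trans (+-comm (b * b) (a * a)) a²+b²≡c²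

module RationalSquares where

  open import Data.Nat as ℕ using (ℕ; suc)
  import Data.Nat.Properties as ℕ
  open import Data.Nat.Divisibility using (_∣_; ∣-refl; ∣m+n∣m⇒∣n; n∣m*n)
  open import Data.Nat.Coprimality as Coprime using (1-coprimeTo)
  open import Data.Integer as ℤ using (+_; -[1+_])
  import Data.Integer.Properties as ℤ
  open import Data.Rational using (ℚ; mkℚ; _+_; _*_; toℚᵘ)
  open import Data.Rational.Properties using (normalize-coprime; toℚᵘ-cong; toℚᵘ-homo-+; toℚᵘ-homo-*)
  import Data.Rational.Unnormalised as ℚᵘ
  import Data.Rational.Unnormalised.Properties as ℚᵘ
  open import Data.Product
  open import Relation.Binary.PropositionalEquality
  open NatSquares using (m*m∣n*n⇒m∣n)

  ι≡mkℚ : ∀ m → ι m ≡ mkℚ (+ m) 0 (Coprime.sym (1-coprimeTo m))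
  ι≡mkℚ m = normalize-coprime (Coprime.sym (1-coprimeTo m))

  i*i≡+∣i∣*∣i∣ : ∀ i → i ℤ.* i ≡ + (ℤ.∣ i ∣ ℕ.* ℤ.∣ i ∣)
  i*i≡+∣i∣*∣i∣ (+ k)    = sym (ℤ.pos-* k k)
  i*i≡+∣i∣*∣i∣ -[1+ k ] = refl

  ExceedsBySquare : ℚ → ℚ → Set
  ExceedsBySquare p q = ∃[ r ] p ≡ q + r * r

  -- For r = p/q in lowest terms, mq² = nq² + p², so q² ∣ p², hence q ∣ p and q = 1.
  ιm≡ιn+r²⇒m≡n+k² : ∀ {m n} → ExceedsBySquare (ι m) (ι n) → ∃[ k ] m ≡ n ℕ.+ k ℕ.* k
  ιm≡ιn+r²⇒m≡n+k² {m} {n} (mkℚ p d p⊥d , e) = ℤ.∣ p ∣ , m≡n+p²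
    where
    open ≡-Reasoning
    q = suc d
    p² = ℤ.∣ p ∣ ℕ.* ℤ.∣ p ∣
    cross-multiplied : toℚᵘ (ι m) ℚᵘ.≃ ℚᵘ.mkℚᵘ (+ n) 0 ℚᵘ.+ ℚᵘ.mkℚᵘ p d ℚᵘ.* ℚᵘ.mkℚᵘ p d
    cross-multiplied = ℚᵘ.≃-trans (toℚᵘ-cong e)
      (ℚᵘ.≃-trans (toℚᵘ-homo-+ (ι n) _)
        (ℚᵘ.+-cong (toℚᵘ-cong (ι≡mkℚ n)) (toℚᵘ-homo-* (mkℚ p d p⊥d) (mkℚ p d p⊥d))))
    mq²≡nq²+p² : m ℕ.* (q ℕ.* q) ≡ n ℕ.* (q ℕ.* q) ℕ.+ p²
    mq²≡nq²+p² with ℚᵘ.≃-trans (toℚᵘ-cong (sym (ι≡mkℚ m))) cross-multiplied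
    ... | ℚᵘ.*≡* eq = ℤ.+-injective (begin
      + (m ℕ.* (q ℕ.* q))                                   ≡⟨ ℤ.pos-* m (q ℕ.* q) ⟩
      + m ℤ.* + (q ℕ.* q)                                   ≡⟨ cong (λ k → + m ℤ.* + k) (ℕ.*-identityˡ (q ℕ.* q)) ⟨
      + m ℤ.* + (1 ℕ.* (q ℕ.* q))                           ≡⟨ eq ⟩
      (+ n ℤ.* + (q ℕ.* q) ℤ.+ p ℤ.* p ℤ.* + 1) ℤ.* + 1     ≡⟨ ℤ.*-identityʳ _ ⟩
      + n ℤ.* + (q ℕ.* q) ℤ.+ p ℤ.* p ℤ.* + 1               ≡⟨ cong (λ k → + n ℤ.* + (q ℕ.* q) ℤ.+ k) (ℤ.*-identityʳ (p ℤ.* p)) ⟩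
      + n ℤ.* + (q ℕ.* q) ℤ.+ p ℤ.* p                       ≡⟨ cong₂ ℤ._+_ (sym (ℤ.pos-* n (q ℕ.* q))) (i*i≡+∣i∣*∣i∣ p) ⟩
      + (n ℕ.* (q ℕ.* q)) ℤ.+ + p²                          ≡⟨ ℤ.pos-+ (n ℕ.* (q ℕ.* q)) p² ⟨
      + (n ℕ.* (q ℕ.* q) ℕ.+ p²)                            ∎)
    q²∣p² : q ℕ.* q ∣ p²
    q²∣p² = ∣m+n∣m⇒∣n (subst (q ℕ.* q ∣_) mq²≡nq²+p² (n∣m*n m)) (n∣m*n n)
    q≡1 : q ≡ 1
    q≡1 = Coprime.sym (Coprime.recompute p⊥d) (∣-refl , m*m∣n*n⇒m∣n q²∣p²)
    m≡n+p² : m ≡ n ℕ.+ p²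
    m≡n+p² with q≡1
    ... | refl = trans (sym (ℕ.*-identityʳ m)) (trans mq²≡nq²+p² (cong (ℕ._+ p²) (ℕ.*-identityʳ n)))

module CurveDoubling where

  open import Data.Rational
  open import Data.Rational.Properties
  open import Data.Rational.Solver using (module +-*-Solver)
  open import Data.Product
  open import Data.Sum
  open import Data.Empty using (⊥-elim)
  open import Function using (_∘_; id)
  open import Relation.Nullary using (yes; no)
  open import Relation.Binary.PropositionalEquality
  open RationalSquares using (ExceedsBySquare)
  open +-*-Solver

  p≡q+[p-q] : ∀ p q → p ≡ q + (p - q)
  p≡q+[p-q] = solve 2 (λ p q → p := q :+ (p :- q)) refl

  p-q≡0⇒p≡q : ∀ {p q} → p - q ≡ 0ℚ → p ≡ q
  p-q≡0⇒p≡q {p} {q} p-q≡0 = begin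
    p              ≡⟨ p≡q+[p-q] p q ⟩
    q + (p - q)    ≡⟨ cong (q +_) p-q≡0 ⟩
    q + 0ℚ         ≡⟨ +-identityʳ q ⟩
    q              ∎
    where open ≡-Reasoning

  *-zero-product : ∀ {p q} → p * q ≡ 0ℚ → p ≡ 0ℚ ⊎ q ≡ 0ℚ
  *-zero-product {p} {q} pq≡0 with p ≟ 0ℚ
  ... | yes p≡0 = inj₁ p≡0
  ... | no p≢0 = inj₂ (begin
    q                ≡⟨ *-identityˡ q ⟨
    1ℚ * q           ≡⟨ cong (_* q) (*-inverseˡ p) ⟨
    1/ p * p * q     ≡⟨ *-assoc (1/ p) p q ⟩
    1/ p * (p * q)   ≡⟨ cong (1/ p *_) pq≡0 ⟩
    1/ p * 0ℚ        ≡⟨ *-zeroʳ (1/ p) ⟩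
    0ℚ               ∎)
    where
    open ≡-Reasoning
    instance _ = ≢-nonZero p≢0

  *-≢0 : ∀ {p q} → p ≢ 0ℚ → q ≢ 0ℚ → p * q ≢ 0ℚ
  *-≢0 p≢0 q≢0 pq≡0 = [ p≢0 , q≢0 ]′ (*-zero-product pq≡0)

  ι2≢0 : ι 2 ≢ 0ℚ
  ι2≢0 ()

  ι2*p≡p+p : ∀ p → ι 2 * p ≡ p + p
  ι2*p≡p+p = solve 1 (λ p → con (ι 2) :* p := p :+ p) refl

  p+p≡0⇒p≡0 : ∀ {p} → p + p ≡ 0ℚ → p ≡ 0ℚ
  p+p≡0⇒p≡0 {p} p+p≡0 = [ ⊥-elim ∘ ι2≢0 , id ]′ (*-zero-product {ι 2} {p} (trans (ι2*p≡p+p p) p+p≡0))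

  p+p≢0⇒ι2*p≢0 : ∀ {p} → p + p ≢ 0ℚ → ι 2 * p ≢ 0ℚ
  p+p≢0⇒ι2*p≢0 {p} p+p≢0 = p+p≢0 ∘ trans (sym (ι2*p≡p+p p))

  *-cancelʳ-≢0 : ∀ {p q t} → t ≢ 0ℚ → p * t ≡ q * t → p ≡ q
  *-cancelʳ-≢0 {p} {q} {t} t≢0 pt≡qt =
    [ p-q≡0⇒p≡q , ⊥-elim ∘ t≢0 ]′ (*-zero-product {p - q} {t} [p-q]t≡0)
    where
    open ≡-Reasoning
    [p-q]t≡0 : (p - q) * t ≡ 0ℚ
    [p-q]t≡0 = begin
      (p - q) * t     ≡⟨ solve 3 (λ p q t → (p :- q) :* t := p :* t :- q :* t) refl p q t ⟩
      p * t - q * t   ≡⟨ cong (_- q * t) pt≡qt ⟩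
      q * t - q * t   ≡⟨ +-inverseʳ (q * t) ⟩
      0ℚ              ∎

  [p⊘q]*q≡p : ∀ p {q} → q ≢ 0ℚ → (p ⊘ q) * q ≡ p
  [p⊘q]*q≡p p {q} q≢0 with q ≟ 0ℚ
  ... | yes q≡0 = ⊥-elim (q≢0 q≡0)
  ... | no q≢0′ = trans (*-assoc p (1/ q) q) (trans (cong (p *_) (*-inverseˡ q)) (*-identityʳ p))
    where instance _ = ≢-nonZero q≢0′

  square-quotient : ∀ {u v t} → t ≢ 0ℚ → u * (t * t) ≡ v * v → u ≡ (v ⊘ t) * (v ⊘ t)
  square-quotient {u} {v} {t} t≢0 ut²≡v² = *-cancelʳ-≢0 (*-≢0 t≢0 t≢0) (begin
    u * (t * t)                  ≡⟨ ut²≡v² ⟩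
    v * v                        ≡⟨ cong₂ _*_ [v⊘t]t≡v [v⊘t]t≡v ⟨
    (v ⊘ t) * t * ((v ⊘ t) * t)  ≡⟨ solve 2 (λ w t → w :* t :* (w :* t) := w :* w :* (t :* t)) refl (v ⊘ t) t ⟩
    (v ⊘ t) * (v ⊘ t) * (t * t)  ∎)
    where
    open ≡-Reasoning
    [v⊘t]t≡v = [p⊘q]*q≡p v t≢0

  tangent-slope : Curve → ℚ → ℚ → ℚ
  tangent-slope E x y = (ι 3 * x * x + ι 2 * Curve.a₂ E * x + Curve.a₄ E) ⊘ (ι 2 * y)

  double-x : Curve → ℚ → ℚ → ℚ
  double-x E x y = tangent-slope E x y * tangent-slope E x y - Curve.a₂ E - x - x

  double-y : Curve → ℚ → ℚ → ℚ
  double-y E x y = - (tangent-slope E x y * (double-x E x y - x) + y)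

  add-self : ∀ E x y →
    (y + y ≡ 0ℚ × add E (pt x y) (pt x y) ≡ O) ⊎
    (y + y ≢ 0ℚ × add E (pt x y) (pt x y) ≡ pt (double-x E x y) (double-y E x y))
  add-self E x y with x ≟ x
  ... | no x≢x = ⊥-elim (x≢x refl)
  ... | yes _ with y + y ≟ 0ℚ
  ...   | yes 2y≡0 = inj₁ (2y≡0 , refl)
  ...   | no 2y≢0  = inj₂ (2y≢0 , refl)

  order-4⇒double-y≡0 : ∀ {E x y} → HasOrder4 E (pt x y) → y + y ≢ 0ℚ × double-y E x y ≡ 0ℚ
  order-4⇒double-y≡0 {E} {x} {y} (2P≢O , 4P≡O) with add-self E x y
  ... | inj₁ (_ , 2P≡O) = ⊥-elim (2P≢O 2P≡O)
  ... | inj₂ (2y≢0 , 2P≡Q) with add-self E (double-x E x y) (double-y E x y)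
  ...   | inj₁ (2Y≡0 , _)  = 2y≢0 , p+p≡0⇒p≡0 2Y≡0
  ...   | inj₂ (_ , 2Q≡R) with trans (sym 2Q≡R) (subst (λ Q → add E Q Q ≡ O) 2P≡Q 4P≡O)
  ...     | ()

  E[_,_] : ℚ → ℚ → Curve
  E[ A , B ] = curve (- (A + B)) (A * B) 0ℚ

  E[A,B]≡E[B,A] : ∀ A B → E[ A , B ] ≡ E[ B , A ]
  E[A,B]≡E[B,A] A B = cong₂ (λ a₂ a₄ → curve a₂ a₄ 0ℚ) (cong -_ (+-comm A B)) (*-comm A B)

  cubic : ℚ → ℚ → ℚ → ℚ
  cubic A B t = t * t * t + - (A + B) * t * t + A * B * t + 0ℚ

  cubic′ : ℚ → ℚ → ℚ → ℚ
  cubic′ A B t = ι 3 * t * t + ι 2 * - (A + B) * t + A * B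

  cubic-roots : ∀ A B s → s * (s - A) * (s - B) ≡ cubic A B s
  cubic-roots = solve 3 (λ A B s → s :* (s :- A) :* (s :- B) := s :* s :* s :+ :- (A :+ B) :* s :* s :+ A :* B :* s :+ con 0ℚ) refl

  cubic-taylor : ∀ A B x s →
    cubic A B s ≡ cubic A B x + cubic′ A B x * (s - x) + (s - x) * (s - x) * (s + x + x - (A + B))
  cubic-taylor = solve 4 (λ A B x s →
    let f t  = t :* t :* t :+ :- (A :+ B) :* t :* t :+ A :* B :* t :+ con 0ℚ
        f′ t = con (ι 3) :* t :* t :+ con (ι 2) :* :- (A :+ B) :* t :+ A :* B
    in f s := f x :+ f′ x :* (s :- x) :+ (s :- x) :* (s :- x) :* (s :+ x :+ x :- (A :+ B))) refl

  -- For s = x(2P) one has (s − B)(2y)² = f′(x)² + 4(A − 2x)f(x) on the curve y² = f(x),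
  -- so this identity exhibits s − B as a square.
  cubic′²-discriminant : ∀ A B x →
    cubic′ A B x * cubic′ A B x + ι 4 * (A - x - x) * cubic A B x ≡
    ((x - B) * (x - B) + B * (A - B)) * ((x - B) * (x - B) + B * (A - B))
  cubic′²-discriminant = solve 3 (λ A B x →
    let f t  = t :* t :* t :+ :- (A :+ B) :* t :* t :+ A :* B :* t :+ con 0ℚ
        f′ t = con (ι 3) :* t :* t :+ con (ι 2) :* :- (A :+ B) :* t :+ A :* B
        q    = (x :- B) :* (x :- B) :+ B :* (A :- B)
    in f′ x :* f′ x :+ con (ι 4) :* (A :- x :- x) :* f x := q :* q) refl

  module Doubling {A B x y : ℚ} (on-curve : OnCurve E[ A , B ] (pt x y)) (2y≢0 : y + y ≢ 0ℚ) where
    private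
      open ≡-Reasoning
      l = tangent-slope E[ A , B ] x y
      s = double-x E[ A , B ] x y
      lT≡f′ : l * (ι 2 * y) ≡ cubic′ A B x
      lT≡f′ = [p⊘q]*q≡p (cubic′ A B x) (p+p≢0⇒ι2*p≢0 {y} 2y≢0)

    double-x-on-curve : cubic A B s ≡ (l * (s - x) + y) * (l * (s - x) + y)
    double-x-on-curve = begin
      cubic A B s
        ≡⟨ cubic-taylor A B x s ⟩
      cubic A B x + cubic′ A B x * (s - x) + (s - x) * (s - x) * (s + x + x - (A + B))
        ≡⟨ cong₂ (λ u v → u + v * (s - x) + (s - x) * (s - x) * (s + x + x - (A + B))) on-curve lT≡f′ ⟨
      y * y + l * (ι 2 * y) * (s - x) + (s - x) * (s - x) * (s + x + x - (A + B))
        ≡⟨ cong (λ v → y * y + l * (ι 2 * y) * (s - x) + (s - x) * (s - x) * v)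
                (solve 4 (λ l x A B → (l :* l :- :- (A :+ B) :- x :- x) :+ x :+ x :- (A :+ B) := l :* l) refl l x A B) ⟩
      y * y + l * (ι 2 * y) * (s - x) + (s - x) * (s - x) * (l * l)
        ≡⟨ solve 3 (λ y l u → y :* y :+ l :* (con (ι 2) :* y) :* u :+ u :* u :* (l :* l) := (l :* u :+ y) :* (l :* u :+ y)) refl y l (s - x) ⟩
      (l * (s - x) + y) * (l * (s - x) + y) ∎

    double-x-exceeds-B-by-square : ExceedsBySquare s B
    double-x-exceeds-B-by-square =
      q ⊘ (ι 2 * y) , trans (p≡q+[p-q] s B) (cong (B +_) (square-quotient {s - B} {q} (p+p≢0⇒ι2*p≢0 {y} 2y≢0) [s-B]T²≡q²))
      where
      q = (x - B) * (x - B) + B * (A - B)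
      [s-B]T²≡q² : (s - B) * (ι 2 * y * (ι 2 * y)) ≡ q * q
      [s-B]T²≡q² = begin
        (s - B) * (ι 2 * y * (ι 2 * y))
          ≡⟨ solve 5 (λ l x y A B → (l :* l :- :- (A :+ B) :- x :- x :- B) :* (con (ι 2) :* y :* (con (ι 2) :* y))
                                   := l :* (con (ι 2) :* y) :* (l :* (con (ι 2) :* y)) :+ con (ι 4) :* (A :- x :- x) :* (y :* y))
                     refl l x y A B ⟩
        l * (ι 2 * y) * (l * (ι 2 * y)) + ι 4 * (A - x - x) * (y * y)
          ≡⟨ cong₂ (λ u v → u * u + ι 4 * (A - x - x) * v) lT≡f′ on-curve ⟩
        cubic′ A B x * cubic′ A B x + ι 4 * (A - x - x) * cubic A B x
          ≡⟨ cubic′²-discriminant A B x ⟩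
        q * q ∎

    double-y≡0⇒double-x-root : double-y E[ A , B ] x y ≡ 0ℚ → s ≡ 0ℚ ⊎ s ≡ A ⊎ s ≡ B
    double-y≡0⇒double-x-root Y≡0 =
      [ (λ s[s-A]≡0 → [ inj₁ , inj₂ ∘ inj₁ ∘ p-q≡0⇒p≡q ]′ (*-zero-product s[s-A]≡0))
      , inj₂ ∘ inj₂ ∘ p-q≡0⇒p≡q ]′ (*-zero-product s[s-A][s-B]≡0)
      where
      s[s-A][s-B]≡0 : s * (s - A) * (s - B) ≡ 0ℚ
      s[s-A][s-B]≡0 = begin
        s * (s - A) * (s - B)                   ≡⟨ cubic-roots A B s ⟩
        cubic A B s                             ≡⟨ double-x-on-curve ⟩
        (l * (s - x) + y) * (l * (s - x) + y)   ≡⟨ cong (λ Y → Y * Y) (neg-injective {q = 0ℚ} Y≡0) ⟩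
        0ℚ * 0ℚ                                 ≡⟨ *-zeroˡ 0ℚ ⟩
        0ℚ                                      ∎

  order-4⇒root-exceeds-root-by-square : ∀ {A B P} → OnCurve E[ A , B ] P → HasOrder4 E[ A , B ] P →
    ExceedsBySquare A B ⊎ ExceedsBySquare B A ⊎ ExceedsBySquare 0ℚ B
  order-4⇒root-exceeds-root-by-square {P = O} _ (2O≢O , _) = ⊥-elim (2O≢O refl)
  order-4⇒root-exceeds-root-by-square {A} {B} {pt x y} on-curve order-4 =
    [ (λ s≡0 → inj₂ (inj₂ (subst (λ t → ExceedsBySquare t B) s≡0 s-exceeds-B)))
    , [ (λ s≡A → inj₁ (subst (λ t → ExceedsBySquare t B) s≡A s-exceeds-B))
      , (λ s≡B → inj₂ (inj₁ (subst (λ t → ExceedsBySquare t A) s≡B s-exceeds-A))) ]′ ]′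
    (Doubling.double-y≡0⇒double-x-root {A} {B} {x} {y} on-curve 2y≢0 Y≡0)
    where
    2y≢0 : y + y ≢ 0ℚ
    2y≢0 = proj₁ (order-4⇒double-y≡0 {E[ A , B ]} {x} {y} order-4)
    Y≡0 : double-y E[ A , B ] x y ≡ 0ℚ
    Y≡0 = proj₂ (order-4⇒double-y≡0 {E[ A , B ]} {x} {y} order-4)
    s-exceeds-B : ExceedsBySquare (double-x E[ A , B ] x y) B
    s-exceeds-B = Doubling.double-x-exceeds-B-by-square {A} {B} {x} {y} on-curve 2y≢0
    s-exceeds-A : ExceedsBySquare (double-x E[ A , B ] x y) A
    s-exceeds-A = subst (λ E → ExceedsBySquare (double-x E x y) A) (sym (E[A,B]≡E[B,A] A B))
      (Doubling.double-x-exceeds-B-by-square {B} {A} {x} {y} (subst (λ E → OnCurve E (pt x y)) (E[A,B]≡E[B,A] A B) on-curve) 2y≢0)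

open import Data.Nat as ℕ using (_*_)
open import Data.Nat.Properties using (m+n≡0⇒m≡0; n>0⇒n≢0)
open import Data.Product using (_,_)
open import Data.Sum using ([_,_]′)
open import Data.Empty using (⊥)
open import Relation.Binary.PropositionalEquality using (sym)
open NatSquares using (square≢0)
open FourthPowers using (legs-differ-by-non-square; primitive-triple-swap)
open RationalSquares using (ExceedsBySquare; ιm≡ιn+r²⇒m≡n+k²)
open CurveDoubling using (order-4⇒root-exceeds-root-by-square)

theorem5p2 : (a b c : ℕ) → PrimitivePythagoreanTriple a b c →
    (P : Point) → OnCurve (E-ab a b) P → ¬ HasOrder4 (E-ab a b) P
theorem5p2 a b c triple@(_ , 0<b , _) P on-curve order-4 =
  [ a²-exceeds-b² , [ b²-exceeds-a² , 0-exceeds-b² ]′ ]′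
    (order-4⇒root-exceeds-root-by-square {ι (a * a)} {ι (b * b)} {P} on-curve order-4)
  where
  a²-exceeds-b² : ExceedsBySquare (ι (a * a)) (ι (b * b)) → ⊥
  a²-exceeds-b² gap = let d , a²≡b²+d² = ιm≡ιn+r²⇒m≡n+k² {a * a} {b * b} gap in
    legs-differ-by-non-square d triple a²≡b²+d²
  b²-exceeds-a² : ExceedsBySquare (ι (b * b)) (ι (a * a)) → ⊥
  b²-exceeds-a² gap = let d , b²≡a²+d² = ιm≡ιn+r²⇒m≡n+k² {b * b} {a * a} gap in
    legs-differ-by-non-square d (primitive-triple-swap triple) b²≡a²+d²
  0-exceeds-b² : ExceedsBySquare (ι 0) (ι (b * b)) → ⊥
  0-exceeds-b² gap = let d , 0≡b²+d² = ιm≡ιn+r²⇒m≡n+k² {0} {b * b} gap in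
    square≢0 (n>0⇒n≢0 0<b) (m+n≡0⇒m≡0 (b * b) (sym 0≡b²+d²))
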